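{- The graph $G_{22}=\overline{L(C_{11}(\{1,3\}))}$ is not co-triangle; that is, the line graph $L(C_{11}(\{1,3\}))$ is not a triangle graph.
   Context: $C_{11}(\{1,3\})$ is the circulant graph with vertex set $\mathbb{Z}_{11}$ in which $i$ and $j$ are adjacent iff $i-j\in\{\pm1,\pm3\}\pmod{11}$. $L(H)$ denotes the line graph of $H$ and $\overline{G}$ the complement of $G$. A graph $G$ is triangle if for every maximal stable set $S$ and every edge $uv$ with $u,v\notin S$ there is $s\in S$ adjacent to both $u$ and $v$; $G$ is co-triangle if $\overline{G}$ is triangle. -}

module Defs where

open import Level using (0ℓ)
open import Data.Bool using (Bool; true; false; T; _∨_)
open import Data.Nat using (ℕ; _+_; _∸_; _%_; _≡ᵇ_)
open import Data.Fin using (Fin; toℕ; _<_)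
open import Data.Product using (Σ; _×_; _,_; ∃-syntax; proj₁; proj₂)
open import Data.Sum using (_⊎_)
open import Relation.Nullary using (¬_)
open import Relation.Unary using (Pred; _⊆_)
open import Relation.Binary.PropositionalEquality using (_≡_)

record Graph : Set₁ where
  field
    V   : Set
    Adj : V → V → Set

open Graph public

-- Graphs on the vertex set Fin n given by a Boolean adjacency function.
-- (Only pairs u < v are consulted when forming edges, so this represents the
-- simple graph with edge set {{u,v} : u < v, adj u v}.)
record FinGraph (n : ℕ) : Set where
  constructor mkFinGraph
  field
    adj : Fin n → Fin n → Bool

open FinGraph public

asGraph : ∀ {n} → FinGraph n → Graph
asGraph {n} H = record { V = Fin n ; Adj = λ i j → T (adj H i j) }

Edge : ∀ {n} → FinGraph n → Set
Edge {n} H = Σ (Fin n × Fin n) λ p → (proj₁ p < proj₂ p) × T (adj H (proj₁ p) (proj₂ p))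

src tgt : ∀ {n} {H : FinGraph n} → Edge H → Fin n
src e = proj₁ (proj₁ e)
tgt e = proj₂ (proj₁ e)

LineGraph : ∀ {n} → FinGraph n → Graph
LineGraph H = record
  { V   = Edge H
  ; Adj = λ e f → ¬ (proj₁ e ≡ proj₁ f)
                  × (src {H = H} e ≡ src {H = H} f ⊎ src {H = H} e ≡ tgt {H = H} f
                     ⊎ tgt {H = H} e ≡ src {H = H} f ⊎ tgt {H = H} e ≡ tgt {H = H} f) }

-- The circulant graph C_11({1,3}): i ~ j iff i - j ∈ {±1, ±3} (mod 11).
diff11 : Fin 11 → Fin 11 → ℕ
diff11 i j = (toℕ i + (11 ∸ toℕ j)) % 11

c11adj : Fin 11 → Fin 11 → Bool
c11adj i j = let d = diff11 i j in
  (d ≡ᵇ 1) ∨ (d ≡ᵇ 3) ∨ (d ≡ᵇ 8) ∨ (d ≡ᵇ 10)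

Stable : (G : Graph) → Pred (V G) 0ℓ → Set
Stable G S = ∀ x y → S x → S y → ¬ Adj G x y

MaximalStable : (G : Graph) → Pred (V G) 0ℓ → Set₁
MaximalStable G S = Stable G S × (∀ (S′ : Pred (V G) 0ℓ) → Stable G S′ → S ⊆ S′ → S′ ⊆ S)

IsTriangle : Graph → Set₁
IsTriangle G = ∀ (S : Pred (V G) 0ℓ) → MaximalStable G S →
  ∀ u v → Adj G u v → ¬ S u → ¬ S v →
  ∃[ s ] (S s × Adj G s u × Adj G s v)

C11-13 : FinGraph 11
C11-13 = mkFinGraph c11adj

module Submission where

-- Stable sets of the line graph L(H) are the matchings of H, and the
-- triangle condition asks that any two intersecting edges outside a maximal
-- matching M meet a common edge of M.  In C₁₁({1,3}) the five "difference 1"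
-- edges 12, 34, 56, 78, 9 10 form a matching M covering every vertex except 0.
-- The edges 01 and 03 intersect (at 0), lie outside M, and the only edges of M
-- meeting them are 12 and 34 respectively, so the condition fails.

open import Defs
open import Level using (0ℓ)
open import Data.Bool using (T)
open import Data.Bool.Properties using (T-irrelevant; T?)
open import Data.Vec using ([]; _∷_; lookup)
open import Data.Empty using (⊥-elim)
open import Data.Nat using (ℕ)
open import Data.Fin using (Fin; #_; _<_)
open import Data.Fin.Properties using (_≟_; _<?_; <-irrelevant; <-irrefl; any?; all?)
open import Data.Product using (_×_; _,_; ∃-syntax; proj₁; proj₂)
open import Data.Product.Properties using (≡-dec)
open import Data.Sum using (_⊎_; inj₁; inj₂)
open import Relation.Nullary using (¬_; Dec; yes; no; ¬?)
open import Relation.Binary.Definitions using (DecidableEquality)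
open import Relation.Nullary.Decidable using (True; toWitness; from-yes; _×-dec_; _⊎-dec_; _→-dec_)
open import Relation.Unary using (Pred)
open import Relation.Binary.PropositionalEquality using (_≡_; _≢_; refl; sym; trans; subst; cong₂)

-- A stable set meeting the closed neighbourhood of every vertex cannot be
-- enlarged: a vertex of a larger stable set would be adjacent to a member of S.
dominating-stable⇒maximal : (G : Graph) (S : Pred (V G) 0ℓ) → Stable G S →
  (∀ x → S x ⊎ ∃[ y ] (S y × Adj G x y)) → MaximalStable G S
dominating-stable⇒maximal G S stable dominates = stable , maximal
  where
  maximal : ∀ S′ → Stable G S′ → (∀ {x} → S x → S′ x) → ∀ {x} → S′ x → S x
  maximal S′ stable′ S⊆S′ {x} S′x with dominates x
  ... | inj₁ Sx = Sx
  ... | inj₂ (y , Sy , x~y) = ⊥-elim (stable′ x y S′x (S⊆S′ Sy) x~y)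

Shares : {A : Set} → A × A → A × A → Set
Shares (a , b) (c , d) = a ≡ c ⊎ a ≡ d ⊎ b ≡ c ⊎ b ≡ d

shares? : {A : Set} → DecidableEquality A → (p q : A × A) → Dec (Shares p q)
shares? _≟ₐ_ (a , b) (c , d) = a ≟ₐ c ⊎-dec a ≟ₐ d ⊎-dec b ≟ₐ c ⊎-dec b ≟ₐ d

_∈ₚ_ : {A : Set} → A → A × A → Set
v ∈ₚ (c , d) = v ≡ c ⊎ v ≡ d

∈ₚ? : {A : Set} → DecidableEquality A → (v : A) (p : A × A) → Dec (v ∈ₚ p)
∈ₚ? _≟ₐ_ v (c , d) = v ≟ₐ c ⊎-dec v ≟ₐ d

module _ {n : ℕ} {H : FinGraph n} where

  edge-ext : {e f : Edge H} → proj₁ e ≡ proj₁ f → e ≡ f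
  edge-ext {p , lt , ad} {.p , lt′ , ad′} refl =
    cong₂ (λ x y → p , x , y) (<-irrelevant lt lt′) (T-irrelevant ad ad′)

  in-or-adjacent : (M : Pred (Edge H) 0ℓ) (e f : Edge H) → M f →
    Shares (proj₁ e) (proj₁ f) → M e ⊎ ∃[ f ] (M f × Adj (LineGraph H) e f)
  in-or-adjacent M e f Mf share with ≡-dec _≟_ _≟_ (proj₁ e) (proj₁ f)
  ... | yes e≡f = inj₁ (subst M (sym (edge-ext e≡f)) Mf)
  ... | no e≢f = inj₂ (f , Mf , e≢f , share)

  -- If the edges of M cover every vertex except possibly z, then every edge of
  -- H lies in M or is adjacent in L(H) to an edge of M: one of its two
  -- distinct endpoints differs from z and is covered.
  covering-dominates : (M : Pred (Edge H) 0ℓ) (z : Fin n) →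
    (∀ v → v ≡ z ⊎ ∃[ f ] (M f × v ∈ₚ proj₁ f)) →
    ∀ e → M e ⊎ ∃[ f ] (M f × Adj (LineGraph H) e f)
  covering-dominates M z covers e@((a , b) , a<b , _) with covers a | covers b
  ... | inj₁ a≡z | inj₁ b≡z = ⊥-elim (<-irrefl (trans a≡z (sym b≡z)) a<b)
  ... | inj₂ (f , Mf , a∈f) | _ = in-or-adjacent M e f Mf (via-src a∈f)
    where
    via-src : a ∈ₚ proj₁ f → Shares (a , b) (proj₁ f)
    via-src (inj₁ p) = inj₁ p
    via-src (inj₂ p) = inj₂ (inj₁ p)
  ... | inj₁ _ | inj₂ (f , Mf , b∈f) = in-or-adjacent M e f Mf (via-tgt b∈f)
    where
    via-tgt : b ∈ₚ proj₁ f → Shares (a , b) (proj₁ f)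
    via-tgt (inj₁ p) = inj₂ (inj₂ (inj₁ p))
    via-tgt (inj₂ p) = inj₂ (inj₂ (inj₂ p))

matchingPair : Fin 5 → Fin 11 × Fin 11
matchingPair = lookup ((# 1 , # 2) ∷ (# 3 , # 4) ∷ (# 5 , # 6) ∷ (# 7 , # 8) ∷ (# 9 , # 10) ∷ [])

_≟ₚ_ : DecidableEquality (Fin 11 × Fin 11)
_≟ₚ_ = ≡-dec _≟_ _≟_

matching-edges : ∀ i → proj₁ (matchingPair i) < proj₂ (matchingPair i)
                     × T (c11adj (proj₁ (matchingPair i)) (proj₂ (matchingPair i)))
matching-edges = from-yes (all? λ i →
  proj₁ (matchingPair i) <? proj₂ (matchingPair i)
  ×-dec T? (c11adj (proj₁ (matchingPair i)) (proj₂ (matchingPair i))))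

matching-disjoint : ∀ i j → matchingPair i ≢ matchingPair j →
                    ¬ Shares (matchingPair i) (matchingPair j)
matching-disjoint = from-yes (all? λ i → all? λ j →
  ¬? (matchingPair i ≟ₚ matchingPair j) →-dec ¬? (shares? _≟_ (matchingPair i) (matchingPair j)))

matching-covers : ∀ v → v ≡ # 0 ⊎ ∃[ i ] (v ∈ₚ matchingPair i)
matching-covers = from-yes (all? λ v → v ≟ # 0 ⊎-dec any? λ i → ∈ₚ? _≟_ v (matchingPair i))

matchingEdge : Fin 5 → Edge C11-13
matchingEdge i = matchingPair i , matching-edges i

M : Pred (Edge C11-13) 0ℓ
M e = ∃[ i ] (matchingPair i ≡ proj₁ e)

M-stable : Stable (LineGraph C11-13) M
M-stable _ _ (i , refl) (j , refl) (i≢j , share) = matching-disjoint i j i≢j share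

M-maximal : MaximalStable (LineGraph C11-13) M
M-maximal = dominating-stable⇒maximal (LineGraph C11-13) M M-stable
  (covering-dominates M (# 0) covered)
  where
  covered : ∀ v → v ≡ # 0 ⊎ ∃[ f ] (M f × v ∈ₚ proj₁ f)
  covered v with matching-covers v
  ... | inj₁ v≡0 = inj₁ v≡0
  ... | inj₂ (i , v∈i) = inj₂ (matchingEdge i , (i , refl) , v∈i)

edge : (a b : Fin 11) → {True (a <? b)} → {T (c11adj a b)} → Edge C11-13
edge a b {a<b} {a~b} = (a , b) , toWitness a<b , a~b

u₀ v₀ : Edge C11-13
u₀ = edge (# 0) (# 1)
v₀ = edge (# 0) (# 3)

outside-M : ∀ i → matchingPair i ≢ proj₁ u₀ × matchingPair i ≢ proj₁ v₀
outside-M = from-yes (all? λ i →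
  ¬? (matchingPair i ≟ₚ proj₁ u₀) ×-dec ¬? (matchingPair i ≟ₚ proj₁ v₀))

u₀∉M : ¬ M u₀
u₀∉M (i , eq) = proj₁ (outside-M i) eq

v₀∉M : ¬ M v₀
v₀∉M (i , eq) = proj₂ (outside-M i) eq

no-common-neighbour : ∀ i → ¬ (Shares (matchingPair i) (proj₁ u₀) × Shares (matchingPair i) (proj₁ v₀))
no-common-neighbour = from-yes (all? λ i →
  ¬? (shares? _≟_ (matchingPair i) (proj₁ u₀) ×-dec shares? _≟_ (matchingPair i) (proj₁ v₀)))

proposition37 : ¬ IsTriangle (LineGraph C11-13)
proposition37 triangle
  with triangle M M-maximal u₀ v₀ ((λ ()) , inj₁ refl) u₀∉M v₀∉M
... | _ , (i , refl) , (_ , meets-u₀) , (_ , meets-v₀) = no-common-neighbour i (meets-u₀ , meets-v₀)
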